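{- Let $\pi=\pi_1\cdots\pi_n$ be a permutation and $j,k\in[n]$ with $j<k$. Then $\mathrm{del}_\pi(j)=\mathrm{del}_\pi(k)$ if and only if $\pi_j$ and $\pi_k$ are part of the same run, i.e. each of the pairs $(\pi_i,\pi_{i+1})$ for $j\le i<k$ is a bond.
   Context: For $\pi\in S_n$ and $i\in[n]$, $\mathrm{del}_\pi(i)$ is the permutation of length $n-1$ obtained by deleting the $i$th entry of $\pi$ and standardizing (relabelling the remaining entries by $1,\dots,n-1$ preserving relative order). A pair of positionally adjacent entries $(\pi_i,\pi_{i+1})$ is a bond if $\pi_i-\pi_{i+1}=\pm1$. A run is a sequence of consecutive entries $\pi_i\pi_{i+1}\cdots\pi_{i+m}$ in which every pair of adjacent entries is a bond. -}

module Defs where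

open import Data.Nat using (ℕ; suc; _+_)
open import Data.Fin using (Fin; toℕ; punchIn; punchOut; inject₁)
open import Data.Fin.Permutation using (Permutation′; _⟨$⟩ʳ_)
open import Data.Fin.Properties using (punchInᵢ≢i)
open import Data.Sum using (_⊎_)
open import Relation.Binary.PropositionalEquality using (_≡_; sym)
open import Function using (_∘_)

-- Positions and values are 0-indexed via Fin: position p ∈ Fin n stands for p+1 ∈ [n].
-- A permutation π ∈ S_(suc m) is a bijection Fin (suc m) ↔ Fin (suc m); π_p = π ⟨$⟩ʳ p.

-- Position p of the result is position (punchIn i p) of π (skipping i); its value
-- is standardized relative to the removed value π_i via punchOut (values above π_i
-- drop by one, values below stay).
del : ∀ {m} → Permutation′ (suc m) → Fin (suc m) → Fin m → Fin m
del π i p = punchOut {i = π ⟨$⟩ʳ i} {j = π ⟨$⟩ʳ punchIn i p}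
  (λ eq → punchInᵢ≢i i p (sym (Permutation′-inj π eq)))
  where
  open import Data.Fin.Permutation using (inverseˡ)
  open import Relation.Binary.PropositionalEquality using (cong; trans)
  Permutation′-inj : ∀ {k} (σ : Permutation′ k) {x y} → σ ⟨$⟩ʳ x ≡ σ ⟨$⟩ʳ y → x ≡ y
  Permutation′-inj σ {x} {y} e =
    trans (sym (inverseˡ σ)) (trans (cong (Data.Fin.Permutation._⟨$⟩ˡ_ σ) e) (inverseˡ σ))

Bond : ℕ → ℕ → Set
Bond a b = (a ≡ b + 1) ⊎ (b ≡ a + 1)

-- Standardizing after deleting the value a moves every other value down by
-- one or not at all, according as it lies above or below a.  So if deleting
-- positions j < k gives the same word, then at every position i with j ≤ i < k
-- the values π_(i+1) (seen in del π j) and π_i (seen in del π k) are distinct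
-- and standardize to the same number, hence differ by one.  Conversely, if
-- π_i, π_(i+1) form a bond then no other value lies between them, so deleting
-- either one standardizes the remaining entries identically, and the entry
-- left at position i standardizes to the same number in both words; chaining
-- these equalities along the run gives del π j = del π k.
module Submission where

open import Data.Empty using (⊥-elim)
open import Data.Fin using (Fin; toℕ; inject₁; punchIn; punchOut)
  renaming (zero to fzero; suc to fsuc)
open import Data.Fin.Permutation using (Permutation′; _⟨$⟩ʳ_)
open import Data.Fin.Properties using (toℕ-injective; toℕ-inject₁)
open import Data.Nat using (suc; _≤_; _<_; z≤n; s≤s; z<s; s<s)
open import Data.Nat.Properties
  using (+-comm; <-cmp; ≤∧≢⇒<; <⇒≢; <⇒≤; m<n⇒m<1+n; ≤-reflexive; n<1+n; suc-injective)
open import Data.Product as Product using (_×_; _,_)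
open import Data.Sum as Sum using (_⊎_; inj₁; inj₂)
open import Function using (_∘_)
open import Function.Bundles using (_⇔_; Injection; mk⇔)
open import Function.Properties.Inverse using (↔⇒↣)
open import Relation.Binary.Core using (Rel)
open import Relation.Binary.Definitions using (Reflexive; Transitive; tri<; tri≈; tri>)
open import Relation.Binary.PropositionalEquality
  using (_≡_; _≢_; _≗_; refl; sym; trans; cong; subst; subst₂; module ≡-Reasoning)

open import Defs

Bond-sym : ∀ {a b} → Bond a b → Bond b a
Bond-sym = Sum.swap

Bond-suc : ∀ a → Bond a (suc a)
Bond-suc a = inj₂ (+-comm 1 a)

Bond⇒≡suc : ∀ {a b} → Bond a b → a ≡ suc b ⊎ b ≡ suc a
Bond⇒≡suc {a} {b} (inj₁ a≡b+1) = inj₁ (trans a≡b+1 (+-comm b 1))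
Bond⇒≡suc {a} {b} (inj₂ b≡a+1) = inj₂ (trans b≡a+1 (+-comm a 1))

distinct-within-one⇒Bond : ∀ {c d x y} → x ≡ c ⊎ x ≡ suc c → y ≡ d ⊎ y ≡ suc d →
                           c ≡ d → x ≢ y → Bond x y
distinct-within-one⇒Bond (inj₁ refl) (inj₁ refl) refl x≢y = ⊥-elim (x≢y refl)
distinct-within-one⇒Bond (inj₁ refl) (inj₂ refl) refl _   = Bond-suc _
distinct-within-one⇒Bond (inj₂ refl) (inj₁ refl) refl _   = Bond-sym (Bond-suc _)
distinct-within-one⇒Bond (inj₂ refl) (inj₂ refl) refl x≢y = ⊥-elim (x≢y refl)

≢-suc-pair⇒same-side : ∀ {a x} → x ≢ a → x ≢ suc a →
                        (x < a × x < suc a) ⊎ (a < x × suc a < x)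
≢-suc-pair⇒same-side {a} {x} x≢a x≢1+a with <-cmp x a
... | tri< x<a _ _ = inj₁ (x<a , m<n⇒m<1+n x<a)
... | tri≈ _ x≡a _ = ⊥-elim (x≢a x≡a)
... | tri> _ _ a<x = inj₂ (a<x , ≤∧≢⇒< a<x (x≢1+a ∘ sym))

Bond⇒same-side : ∀ {a b x} → Bond a b → x ≢ a → x ≢ b → (x < a × x < b) ⊎ (a < x × b < x)
Bond⇒same-side bd x≢a x≢b with Bond⇒≡suc bd
... | inj₁ refl = Sum.map Product.swap Product.swap (≢-suc-pair⇒same-side x≢b x≢a)
... | inj₂ refl = ≢-suc-pair⇒same-side x≢a x≢b

toℕ-punchOut-< : ∀ {n} {i j : Fin (suc n)} (i≢j : i ≢ j) →
                 toℕ j < toℕ i → toℕ (punchOut i≢j) ≡ toℕ j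
toℕ-punchOut-< {suc n} {fsuc i} {fzero}  _   _         = refl
toℕ-punchOut-< {suc n} {fsuc i} {fsuc j} i≢j (s<s j<i) =
  cong suc (toℕ-punchOut-< (i≢j ∘ cong fsuc) j<i)

toℕ-punchOut-> : ∀ {n} {i j : Fin (suc n)} (i≢j : i ≢ j) →
                 toℕ i < toℕ j → suc (toℕ (punchOut i≢j)) ≡ toℕ j
toℕ-punchOut-> {i = fzero}  {fsuc j} _   _ = refl
toℕ-punchOut-> {suc n} {fsuc i} {fsuc j} i≢j (s<s i<j) =
  cong suc (toℕ-punchOut-> (i≢j ∘ cong fsuc) i<j)

toℕ-punchOut : ∀ {n} {i j : Fin (suc n)} (i≢j : i ≢ j) →
               toℕ j ≡ toℕ (punchOut i≢j) ⊎ toℕ j ≡ suc (toℕ (punchOut i≢j))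
toℕ-punchOut {i = i} {j} i≢j with <-cmp (toℕ j) (toℕ i)
... | tri< j<i _ _ = inj₁ (sym (toℕ-punchOut-< i≢j j<i))
... | tri≈ _ j≡i _ = ⊥-elim (i≢j (toℕ-injective (sym j≡i)))
... | tri> _ _ i<j = inj₂ (sym (toℕ-punchOut-> i≢j i<j))

punchIn-< : ∀ {n} (i : Fin (suc n)) (j : Fin n) → toℕ j < toℕ i → punchIn i j ≡ inject₁ j
punchIn-< (fsuc i) fzero    _         = refl
punchIn-< (fsuc i) (fsuc j) (s<s j<i) = cong fsuc (punchIn-< i j j<i)

punchIn-≥ : ∀ {n} (i : Fin (suc n)) (j : Fin n) → toℕ i ≤ toℕ j → punchIn i j ≡ fsuc j
punchIn-≥ fzero    j        _         = refl
punchIn-≥ (fsuc i) (fsuc j) (s≤s i≤j) = cong fsuc (punchIn-≥ i j i≤j)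

inject₁≢suc : ∀ {n} (i : Fin n) → inject₁ i ≢ fsuc i
inject₁≢suc i eq = <⇒≢ (n<1+n (toℕ i)) (trans (sym (toℕ-inject₁ i)) (cong toℕ eq))

punchOut-≡⇒Bond : ∀ {n} {a b x y : Fin (suc n)} (a≢x : a ≢ x) (b≢y : b ≢ y) → x ≢ y →
                  punchOut a≢x ≡ punchOut b≢y → Bond (toℕ x) (toℕ y)
punchOut-≡⇒Bond a≢x b≢y x≢y eq = distinct-within-one⇒Bond
  (toℕ-punchOut a≢x) (toℕ-punchOut b≢y) (cong toℕ eq) (x≢y ∘ toℕ-injective)

punchOut-cong-Bond : ∀ {n} {a b x y : Fin (suc n)} → Bond (toℕ a) (toℕ b) →
                     (a≢x : a ≢ x) (b≢y : b ≢ y) → x ≡ y → punchOut a≢x ≡ punchOut b≢y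
punchOut-cong-Bond bd a≢x b≢x refl
  with Bond⇒same-side bd (a≢x ∘ sym ∘ toℕ-injective) (b≢x ∘ sym ∘ toℕ-injective)
... | inj₁ (x<a , x<b) = toℕ-injective
  (trans (toℕ-punchOut-< a≢x x<a) (sym (toℕ-punchOut-< b≢x x<b)))
... | inj₂ (a<x , b<x) = toℕ-injective (suc-injective
  (trans (toℕ-punchOut-> a≢x a<x) (sym (toℕ-punchOut-> b≢x b<x))))

punchOut-swap-suc : ∀ {n} {a b : Fin (suc n)} → toℕ b ≡ suc (toℕ a) →
                    (a≢b : a ≢ b) (b≢a : b ≢ a) → punchOut a≢b ≡ punchOut b≢a
punchOut-swap-suc {a = a} {b} b≡1+a a≢b b≢a = toℕ-injective (suc-injective (begin
  suc (toℕ (punchOut a≢b)) ≡⟨ toℕ-punchOut-> a≢b a<b ⟩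
  toℕ b                    ≡⟨ b≡1+a ⟩
  suc (toℕ a)              ≡⟨ cong suc (toℕ-punchOut-< b≢a a<b) ⟨
  suc (toℕ (punchOut b≢a)) ∎))
  where
  open ≡-Reasoning
  a<b : toℕ a < toℕ b
  a<b = ≤-reflexive (sym b≡1+a)

punchOut-swap-Bond : ∀ {n} {a b x y : Fin (suc n)} → Bond (toℕ a) (toℕ b) →
                     (a≢x : a ≢ x) (b≢y : b ≢ y) → x ≡ b → y ≡ a → punchOut a≢x ≡ punchOut b≢y
punchOut-swap-Bond bd a≢b b≢a refl refl with Bond⇒≡suc bd
... | inj₁ a≡1+b = sym (punchOut-swap-suc a≡1+b b≢a a≢b)
... | inj₂ b≡1+a = punchOut-swap-suc b≡1+a a≢b b≢a

module _ {a ℓ} {A : Set a} {_∼_ : Rel A ℓ} (∼-refl : Reflexive _∼_) (∼-trans : Transitive _∼_) where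

  consecutive⇒related : ∀ {m} (f : Fin (suc m) → A) {j k : Fin (suc m)} → toℕ j ≤ toℕ k →
    (∀ (i : Fin m) → toℕ j ≤ toℕ i → toℕ i < toℕ k → f (inject₁ i) ∼ f (fsuc i)) →
    f j ∼ f k
  consecutive⇒related f {fzero} {fzero} _ _ = ∼-refl
  consecutive⇒related {suc m} f {fzero} {fsuc k} _ step =
    ∼-trans (step fzero z≤n z<s)
            (consecutive⇒related (f ∘ fsuc) z≤n (λ i _ i<k → step (fsuc i) z≤n (s<s i<k)))
  consecutive⇒related {suc m} f {fsuc j} {fsuc k} (s≤s j≤k) step =
    consecutive⇒related (f ∘ fsuc) j≤k (λ i j≤i i<k → step (fsuc i) (s≤s j≤i) (s<s i<k))

module _ {m} (π : Permutation′ (suc m)) where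

  private
    π-injective : ∀ {x y} → π ⟨$⟩ʳ x ≡ π ⟨$⟩ʳ y → x ≡ y
    π-injective = Injection.injective (↔⇒↣ π)

  del-≡⇒Bond : ∀ {j k} (i : Fin m) → toℕ j ≤ toℕ i → toℕ i < toℕ k → del π j i ≡ del π k i →
               Bond (toℕ (π ⟨$⟩ʳ inject₁ i)) (toℕ (π ⟨$⟩ʳ fsuc i))
  del-≡⇒Bond {j} {k} i j≤i i<k eq =
    subst₂ (λ x y → Bond (toℕ (π ⟨$⟩ʳ x)) (toℕ (π ⟨$⟩ʳ y))) k-side j-side
      (punchOut-≡⇒Bond {a = π ⟨$⟩ʳ k} {b = π ⟨$⟩ʳ j} _ _ distinct (sym eq))
    where
    k-side : punchIn k i ≡ inject₁ i
    k-side = punchIn-< k i i<k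
    j-side : punchIn j i ≡ fsuc i
    j-side = punchIn-≥ j i j≤i
    distinct : π ⟨$⟩ʳ punchIn k i ≢ π ⟨$⟩ʳ punchIn j i
    distinct same = inject₁≢suc i (trans (sym k-side) (trans (π-injective same) j-side))

  Bond⇒del-≗ : (i : Fin m) → Bond (toℕ (π ⟨$⟩ʳ inject₁ i)) (toℕ (π ⟨$⟩ʳ fsuc i)) →
               del π (inject₁ i) ≗ del π (fsuc i)
  Bond⇒del-≗ i bd p with <-cmp (toℕ p) (toℕ i)
  ... | tri< p<i _ _ = punchOut-cong-Bond bd _ _ (cong (π ⟨$⟩ʳ_) (trans
    (punchIn-< (inject₁ i) p (subst (toℕ p <_) (sym (toℕ-inject₁ i)) p<i))
    (sym (punchIn-< (fsuc i) p (m<n⇒m<1+n p<i)))))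
  ... | tri> _ _ i<p = punchOut-cong-Bond bd _ _ (cong (π ⟨$⟩ʳ_) (trans
    (punchIn-≥ (inject₁ i) p (subst (_≤ toℕ p) (sym (toℕ-inject₁ i)) (<⇒≤ i<p)))
    (sym (punchIn-≥ (fsuc i) p i<p))))
  ... | tri≈ _ p≡i _ rewrite toℕ-injective p≡i = punchOut-swap-Bond bd _ _
    (cong (π ⟨$⟩ʳ_) (punchIn-≥ (inject₁ i) i (≤-reflexive (toℕ-inject₁ i))))
    (cong (π ⟨$⟩ʳ_) (punchIn-< (fsuc i) i (n<1+n (toℕ i))))

lemma5p5 : ∀ m (π : Permutation′ (suc m)) (j k : Fin (suc m)) → toℕ j < toℕ k →
    ((∀ p → del π j p ≡ del π k p) ⇔
     (∀ (i : Fin m) → toℕ j ≤ toℕ i → toℕ i < toℕ k →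
        Bond (toℕ (π ⟨$⟩ʳ inject₁ i)) (toℕ (π ⟨$⟩ʳ fsuc i))))
lemma5p5 m π j k j<k = mk⇔
  (λ del≗ i j≤i i<k → del-≡⇒Bond π i j≤i i<k (del≗ i))
  (λ bonds → consecutive⇒related {_∼_ = _≗_} ≗-refl ≗-trans (del π) (<⇒≤ j<k)
     (λ i j≤i i<k → Bond⇒del-≗ π i (bonds i j≤i i<k)))
  where
  ≗-refl : Reflexive {A = Fin m → Fin m} _≗_
  ≗-refl _ = refl
  ≗-trans : Transitive {A = Fin m → Fin m} _≗_
  ≗-trans f≗g g≗h x = trans (f≗g x) (g≗h x)
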